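{- Let $\mathbf{L}$ be a dually ms Stone semi-Heyting algebra and $x\in L$. Then $(x^*)' \le ((x^{**})')^*$.
   Context: A semi-Heyting algebra is an algebra $\langle L,\vee,\wedge,\to,0,1\rangle$ such that $\langle L,\vee,\wedge,0,1\rangle$ is a bounded lattice and the identities $x\wedge(x\to y)\approx x\wedge y$, $x\wedge(y\to z)\approx x\wedge[(x\wedge y)\to(x\wedge z)]$, and $x\to x\approx 1$ hold; $x^* := x\to 0$ is the pseudocomplement. A dually quasi-De Morgan semi-Heyting algebra is an algebra $\langle L,\vee,\wedge,\to,{}',0,1\rangle$ whose reduct $\langle L,\vee,\wedge,\to,0,1\rangle$ is a semi-Heyting algebra and which satisfies $0'\approx 1$, $1'\approx 0$, $(x\wedge y)'\approx x'\vee y'$, $(x\vee y)''\approx x''\vee y''$, and $x''\le x$. A dually ms Stone semi-Heyting algebra is a dually quasi-De Morgan semi-Heyting algebra that additionally satisfies $(x\vee y)'\approx x'\wedge y'$ and the Stone identity $x^*\vee x^{**}\approx 1$. -}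

module Defs where

open import Level using (Level; suc; _⊔_)
open import Relation.Binary.PropositionalEquality using (_≡_)
open import Algebra.Lattice.Structures using (IsLattice)

record DmsStoneSH (c : Level) : Set (suc c) where
  infixr 5 _⇒_
  infixr 6 _∨_
  infixr 7 _∧_
  field
    Carrier : Set c
    _∨_ _∧_ _⇒_ : Carrier → Carrier → Carrier
    ′_ : Carrier → Carrier
    𝟘 𝟙 : Carrier
    isLattice : IsLattice _≡_ _∨_ _∧_
    ∧-zero : ∀ x → 𝟘 ∧ x ≡ 𝟘
    ∨-one  : ∀ x → 𝟙 ∨ x ≡ 𝟙
  _≤_ : Carrier → Carrier → Set c
  x ≤ y = x ∧ y ≡ x
  _* : Carrier → Carrier
  x * = x ⇒ 𝟘
  infix 4 _≤_
  infix 9 _*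
  field
    sh1 : ∀ x y → x ∧ (x ⇒ y) ≡ x ∧ y
    sh2 : ∀ x y z → x ∧ (y ⇒ z) ≡ x ∧ ((x ∧ y) ⇒ (x ∧ z))
    sh3 : ∀ x → x ⇒ x ≡ 𝟙
    dq1 : ′ 𝟘 ≡ 𝟙
    dq2 : ′ 𝟙 ≡ 𝟘
    dq3 : ∀ x y → ′ (x ∧ y) ≡ ′ x ∨ ′ y
    dq4 : ∀ x y → ′ ′ (x ∨ y) ≡ ′ ′ x ∨ ′ ′ y
    dq5 : ∀ x → ′ ′ x ≤ x
    dms : ∀ x y → ′ (x ∨ y) ≡ ′ x ∧ ′ y
    stone : ∀ x → x * ∨ x * * ≡ 𝟙

module Submission where

--   (1) In any semi-Heyting algebra the pseudocomplement y* is an upper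
--       bound of every element disjoint from y: if z ∧ y = 0 then z ≤ y*.
--       This follows from the identity z ∧ (y → 0) = z ∧ ((z ∧ y) → (z ∧ 0))
--       together with 0 → 0 = 1.
--   (2) In a dually ms algebra the operation ′ turns joins into meets and
--       sends 1 to 0, so complementary pairs (u ∨ v = 1) are mapped to
--       disjoint pairs (u′ ∧ v′ = 0).
--
-- The Stone identity x* ∨ x** = 1 says that x* and x** are complementary,
-- so by (2) the elements (x*)′ and (x**)′ are disjoint, and (1) gives
-- (x*)′ ≤ ((x**)′)*.

open import Defs
open import Relation.Binary.PropositionalEquality
open import Algebra.Lattice.Structures using (IsLattice)

module _ {c} (L : DmsStoneSH c) where
  open DmsStoneSH L
  open IsLattice isLattice using (∧-comm; ∨-comm; ∧-absorbs-∨)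
  open ≡-Reasoning

  ∧-identityʳ : ∀ y → y ∧ 𝟙 ≡ y
  ∧-identityʳ y = begin
    y ∧ 𝟙        ≡⟨ cong (y ∧_) (sym (∨-one y)) ⟩
    y ∧ (𝟙 ∨ y)  ≡⟨ cong (y ∧_) (∨-comm 𝟙 y) ⟩
    y ∧ (y ∨ 𝟙)  ≡⟨ ∧-absorbs-∨ y 𝟙 ⟩
    y            ∎

  ∧-zeroʳ : ∀ y → y ∧ 𝟘 ≡ 𝟘
  ∧-zeroʳ y = trans (∧-comm y 𝟘) (∧-zero y)

  disjoint⇒≤* : ∀ z y → z ∧ y ≡ 𝟘 → z ≤ y *
  disjoint⇒≤* z y z∧y≡𝟘 = begin
    z ∧ (y ⇒ 𝟘)              ≡⟨ sh2 z y 𝟘 ⟩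
    z ∧ ((z ∧ y) ⇒ (z ∧ 𝟘))  ≡⟨ cong₂ (λ u v → z ∧ (u ⇒ v)) z∧y≡𝟘 (∧-zeroʳ z) ⟩
    z ∧ (𝟘 ⇒ 𝟘)              ≡⟨ cong (z ∧_) (sh3 𝟘) ⟩
    z ∧ 𝟙                    ≡⟨ ∧-identityʳ z ⟩
    z                        ∎

  complementary⇒′-disjoint : ∀ u v → u ∨ v ≡ 𝟙 → ′ u ∧ ′ v ≡ 𝟘
  complementary⇒′-disjoint u v u∨v≡𝟙 = begin
    ′ u ∧ ′ v  ≡⟨ sym (dms u v) ⟩
    ′ (u ∨ v)  ≡⟨ cong ′_ u∨v≡𝟙 ⟩
    ′ 𝟙        ≡⟨ dq2 ⟩
    𝟘          ∎

lemma4p3 : ∀ {c} (L : DmsStoneSH c) → let open DmsStoneSH L in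
    ∀ (x : DmsStoneSH.Carrier L) → ′ (x *) ≤ (′ (x * *)) *
lemma4p3 L x =
  disjoint⇒≤* L (′ (x *)) (′ (x * *))
    (complementary⇒′-disjoint L (x *) (x * *) (stone x))
  where open DmsStoneSH L
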